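{- Let $p$ be a term over state type $\alpha$, $q$ a term over state type $\beta$, $\rho,\rho'$ code retrieving functions for terms over $\alpha$ and $\beta$ respectively, $r\subseteq\alpha\times\beta$, $R\subseteq\alpha\times\alpha$, $R'\subseteq\beta\times\beta$. Assume $\rho,\rho'\models p\sqsupseteq_r q$, $sq^q$ is a finite potential computation of $(\rho',q)$ satisfying the environment condition for $R'$, and $r;R'\subseteq R;r$. Let $\sigma$ be a state with $(\sigma,\sigma^q_0)\in r$ where $\sigma^q_0$ is the state of $sq^q_0$. Then there is a finite potential computation $sq^p$ of $(\rho,p)$ with $|sq^p|=|sq^q|$ such that: (1) the state of $sq^p_0$ is $\sigma$; (2) $sq^p$ satisfies the environment condition for $R$; (3) $(\text{state of }sq^p_i,\text{state of }sq^q_i)\in r$ for all $i<|sq^q|$; (4) $\rho,\rho'\models(\text{program of }sq^p_i)\sqsupseteq_r(\text{program of }sq^q_i)$ for all $i<|sq^q|$; (5) for all $i<|sq^q|-1$, the transition $i\to i+1$ of $sq^p$ is an environment step iff the transition $i\to i+1$ of $sq^q$ is an environment step.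
   Context: Program terms over a state type $\alpha$ are generated by $p::=\mathbf{skip}\mid\mathbf{basic}\,f\mid\mathbf{cjump}\,C\,i\,p\mid\mathbf{while}\,C\,p\,p\mid\mathbf{if}\,C\,p\,p\mid p;p\mid\Vert(p_1,\dots,p_m)\mid\mathbf{await}\,C\,p$ ($f:\alpha\to\alpha$, $C\subseteq\alpha$, $i\in\mathbb N$, $m\ge1$). A code retrieving function $\rho$ maps $\mathbb N$ to terms. The program step relation $\rho\vdash(p,\sigma)\to_{\mathcal P}(p',\sigma')$ is the least relation with: $(\mathbf{basic}\,f,\sigma)\to(\mathbf{skip},f\sigma)$; $(\mathbf{cjump}\,C\,i\,p,\sigma)\to(\rho\,i,\sigma)$ if $\sigma\in C$, $\to(p,\sigma)$ otherwise; $(\mathbf{await}\,C\,p,\sigma)\to(\mathbf{skip},\sigma')$ if $\sigma\in C$ and $(p,\sigma)\to^*(\mathbf{skip},\sigma')$; $(\mathbf{if}\,C\,p_1\,p_2,\sigma)\to(p_1,\sigma)$ if $\sigma\in C$, $\to(p_2,\sigma)$ otherwise; for $x=\mathbf{while}\,C\,p_1\,p_2$: $(x,\sigma)\to(p_1;(\mathbf{skip};x),\sigma)$ if $\sigma\in C$, $\to(p_2,\sigma)$ otherwise; $(p_1;p_2,\sigma)\to(p_1';p_2,\sigma')$ if $(p_1,\sigma)\to(p_1',\sigma')$; $(\mathbf{skip};p,\sigma)\to(p,\sigma)$; $(\Vert(\dots,p_i,\dots),\sigma)\to(\Vert(\dots,p_i',\dots),\sigma')$ if $(p_i,\sigma)\to(p_i',\sigma')$;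 $(\Vert(\mathbf{skip},\dots,\mathbf{skip}),\sigma)\to(\mathbf{skip},\sigma)$. A finite potential computation of $(\rho,p)$ is a nonempty finite sequence of configurations $sq_0=(p_0,\sigma_0),\dots,sq_{n-1}=(p_{n-1},\sigma_{n-1})$, $|sq|=n$, with $p_0=p$, each transition labelled as a program step ($\rho\vdash(p_i,\sigma_i)\to_{\mathcal P}(p_{i+1},\sigma_{i+1})$) or an environment step ($p_{i+1}=p_i$, state arbitrary). It satisfies the environment condition for $R$ if $(\sigma_i,\sigma_{i+1})\in R$ for every environment step. $r;s=\{(a,b)\mid\exists c.(a,c)\in r\wedge(c,b)\in s\}$. A relation $X$ between terms over $\alpha$ and over $\beta$ is a simulation w.r.t. $\rho,\rho',r$ if (i) whenever $(p,q)\in X$, $(\sigma_1,\sigma_2)\in r$ and $\rho'\vdash(q,\sigma_2)\to_{\mathcal P}(q',\sigma_2')$, there is a step $\rho\vdash(p,\sigma_1)\to_{\mathcal P}(p',\sigma_1')$ with $(p',q')\in X$ and $(\sigma_1',\sigma_2')\in r$; (ii) $(\mathbf{skip},q)\in X\Rightarrow q=\mathbf{skip}$; (iii) $(p,\mathbf{skip})\in X\Rightarrow p=\mathbf{skip}$. $\rho,\rho'\models p\sqsupseteq_r q$ means some simulation w.r.t. $\rho,\rho',r$ contains $(p,q)$. -}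

module Defs where

open import Level using (0ℓ)
open import Data.Nat using (ℕ; zero; suc)
open import Data.Fin using (Fin; zero; suc; inject₁)
open import Data.Vec using (Vec; lookup; _[_]≔_)
open import Data.Vec.Relation.Unary.All using (All)
open import Data.Product using (Σ; ∃; _×_; _,_; proj₁; proj₂)
open import Relation.Unary using (Pred; _∈_; _∉_)
open import Relation.Binary.Core using (REL; Rel)
open import Relation.Binary.PropositionalEquality using (_≡_)

-- Program terms over a state type α.
-- Sets of states C ⊆ α are predicates  Pred α 0ℓ.
-- Parallel composition ‖(p₁,…,pₘ) with m ≥ 1 is  par ps  with ps : Vec _ (suc k).

data Term (α : Set) : Set₁ where
  skip  : Term α
  basic : (α → α) → Term α
  cjump : Pred α 0ℓ → ℕ → Term α → Term α
  while : Pred α 0ℓ → Term α → Term α → Term α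
  if    : Pred α 0ℓ → Term α → Term α → Term α
  _⨟_   : Term α → Term α → Term α
  par   : ∀ {k} → Vec (Term α) (suc k) → Term α
  await : Pred α 0ℓ → Term α → Term α

CodeRet : Set → Set₁
CodeRet α = ℕ → Term α

Config : Set → Set₁
Config α = Term α × α

mutual
  data Step {α : Set} (ρ : CodeRet α) : Config α → Config α → Set₁ where
    basic-step : ∀ f σ → Step ρ (basic f , σ) (skip , f σ)
    cjump-yes  : ∀ {C i p σ} → σ ∈ C → Step ρ (cjump C i p , σ) (ρ i , σ)
    cjump-no   : ∀ {C i p σ} → σ ∉ C → Step ρ (cjump C i p , σ) (p , σ)
    await-step : ∀ {C p σ σ'} → σ ∈ C → Steps ρ (p , σ) (skip , σ') →
                 Step ρ (await C p , σ) (skip , σ')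
    if-yes     : ∀ {C p₁ p₂ σ} → σ ∈ C → Step ρ (if C p₁ p₂ , σ) (p₁ , σ)
    if-no      : ∀ {C p₁ p₂ σ} → σ ∉ C → Step ρ (if C p₁ p₂ , σ) (p₂ , σ)
    while-yes  : ∀ {C p₁ p₂ σ} → σ ∈ C →
                 Step ρ (while C p₁ p₂ , σ) (p₁ ⨟ (skip ⨟ while C p₁ p₂) , σ)
    while-no   : ∀ {C p₁ p₂ σ} → σ ∉ C → Step ρ (while C p₁ p₂ , σ) (p₂ , σ)
    seq-step   : ∀ {p₁ p₁' p₂ σ σ'} → Step ρ (p₁ , σ) (p₁' , σ') →
                 Step ρ (p₁ ⨟ p₂ , σ) (p₁' ⨟ p₂ , σ')
    seq-skip   : ∀ {p σ} → Step ρ (skip ⨟ p , σ) (p , σ)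
    par-step   : ∀ {k} {ps : Vec (Term α) (suc k)} {p' σ σ'} (i : Fin (suc k)) →
                 Step ρ (lookup ps i , σ) (p' , σ') →
                 Step ρ (par ps , σ) (par (ps [ i ]≔ p') , σ')
    par-skip   : ∀ {k} {ps : Vec (Term α) (suc k)} {σ} → All (_≡ skip) ps →
                 Step ρ (par ps , σ) (skip , σ)

  data Steps {α : Set} (ρ : CodeRet α) : Config α → Config α → Set₁ where
    done : ∀ {c} → Steps ρ c c
    more : ∀ {c d e} → Step ρ c d → Steps ρ d e → Steps ρ c e

-- Finite potential computations.  A computation of length  suc n
-- (nonempty) is a sequence of configurations indexed by Fin (suc n)
-- together with a label for each of its n transitions.

data Label : Set where
  progStep envStep : Label

Trans : {α : Set} → CodeRet α → Label → Config α → Config α → Set₁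
Trans ρ progStep c d = Step ρ c d
Trans ρ envStep  c d = proj₁ d ≡ proj₁ c   -- program unchanged, state arbitrary

record PotComp {α : Set} (ρ : CodeRet α) (p : Term α) (n : ℕ) : Set₁ where
  field
    cfg   : Fin (suc n) → Config α
    lbl   : Fin n → Label
    start : proj₁ (cfg zero) ≡ p
    valid : ∀ (i : Fin n) → Trans ρ (lbl i) (cfg (inject₁ i)) (cfg (suc i))

  prog : Fin (suc n) → Term α
  prog i = proj₁ (cfg i)

  state : Fin (suc n) → α
  state i = proj₂ (cfg i)

EnvCond : {α : Set} {ρ : CodeRet α} {p : Term α} {n : ℕ} →
          Rel α 0ℓ → PotComp ρ p n → Set
EnvCond {n = n} R sq =
  ∀ (i : Fin n) → PotComp.lbl sq i ≡ envStep →
    R (PotComp.state sq (inject₁ i)) (PotComp.state sq (suc i))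

record IsSimulation {α β : Set} (ρ : CodeRet α) (ρ' : CodeRet β)
                    (r : REL α β 0ℓ) (X : Term α → Term β → Set₁) : Set₁ where
  field
    sim : ∀ {p q σ₁ σ₂ q' σ₂'} → X p q → r σ₁ σ₂ →
          Step ρ' (q , σ₂) (q' , σ₂') →
          Σ (Term α) λ p' → Σ α λ σ₁' →
            Step ρ (p , σ₁) (p' , σ₁') × X p' q' × r σ₁' σ₂'
    skipˡ : ∀ {q} → X skip q → q ≡ skip
    skipʳ : ∀ {p} → X p skip → p ≡ skip

Refines : {α β : Set} → CodeRet α → CodeRet β → REL α β 0ℓ →
          Term α → Term β → Set₂
Refines {α} {β} ρ ρ' r p q =
  Σ (Term α → Term β → Set₁) λ X → IsSimulation ρ ρ' r X × X p q

infixr 9 _⨾_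
_⨾_ : {A B C : Set} → REL A B 0ℓ → REL B C 0ℓ → REL A C 0ℓ
r ⨾ s = λ a b → ∃ λ c → r a c × s c b

module Submission where

-- A finite potential computation of the concrete program q is lifted to one
-- of the abstract program p transition by transition, following the
-- refinement p ⊒_r q.
--
--  * A program step of q is matched by a program step of p, taken from the
--    simulation witnessing the refinement.  The same simulation relates the
--    successor terms, so refinement is preserved.
--  * An environment step of q, which is admissible for R', is matched by an
--    environment step of p.  The side condition  r ; R' ⊆ R ; r  supplies an
--    R-successor state that is again r-related (`matchTransition`).
--
-- The
-- induction (`lift`) on the length of the concrete computation maintains the
-- invariant `Mirrors`: states are r-related and programs refine pointwise, the
-- abstract computation satisfies the environment condition, and both have
-- identical transition labels.  The main theorem follows immediately, because
-- identical labels make condition (5) trivial.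

open import Defs
open import Level using (0ℓ)
open import Data.Nat using (ℕ; zero; suc)
open import Data.Fin using (Fin; zero; suc; inject₁)
open import Data.Product using (Σ; _×_; _,_)
open import Relation.Binary.Core using (REL; Rel; _⇒_)
open import Relation.Binary.PropositionalEquality
  using (_≡_; refl; sym; subst; cong₂)
open import Function using (id)
open import Function.Bundles using (_⇔_; mk⇔)

tailComp : {α : Set} {ρ : CodeRet α} {p : Term α} {n : ℕ} →
           (sq : PotComp ρ p (suc n)) → PotComp ρ (PotComp.prog sq (suc zero)) n
tailComp sq = record
  { cfg   = λ i → PotComp.cfg sq (suc i)
  ; lbl   = λ i → PotComp.lbl sq (suc i)
  ; start = refl
  ; valid = λ i → PotComp.valid sq (suc i)
  }

consComp : {α : Set} {ρ : CodeRet α} {p p' : Term α} {n : ℕ} (σ : α) (l : Label) →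
           (sq : PotComp ρ p' n) → Trans ρ l (p , σ) (PotComp.cfg sq zero) →
           PotComp ρ p (suc n)
consComp {p = p} σ l sq t = record
  { cfg   = λ { zero → (p , σ) ; (suc i) → PotComp.cfg sq i }
  ; lbl   = λ { zero → l ; (suc i) → PotComp.lbl sq i }
  ; start = refl
  ; valid = λ { zero → t ; (suc i) → PotComp.valid sq i }
  }

headCfg : {α : Set} {ρ : CodeRet α} {p : Term α} {n : ℕ} {σ : α} →
          (sq : PotComp ρ p n) → PotComp.state sq zero ≡ σ →
          PotComp.cfg sq zero ≡ (p , σ)
headCfg sq = cong₂ _,_ (PotComp.start sq)

module Lifting {α β : Set} (ρ : CodeRet α) (ρ' : CodeRet β)
               (r : REL α β 0ℓ) (R : Rel α 0ℓ) (R' : Rel β 0ℓ)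
               (commute : (r ⨾ R') ⇒ (R ⨾ r)) where

  matchTransition :
    ∀ (l : Label) {p q σ τ q' τ'} →
    Refines ρ ρ' r p q → r σ τ →
    Trans ρ' l (q , τ) (q' , τ') → (l ≡ envStep → R' τ τ') →
    Σ (Term α) λ p' → Σ α λ σ' →
      Trans ρ l (p , σ) (p' , σ') × Refines ρ ρ' r p' q' × r σ' τ'
      × (l ≡ envStep → R σ σ')
  matchTransition progStep (X , isSim , pXq) rστ step _
    with IsSimulation.sim isSim pXq rστ step
  ... | p' , σ' , step' , p'Xq' , rσ'τ' =
    p' , σ' , step' , (X , isSim , p'Xq') , rσ'τ' , λ ()
  matchTransition envStep {p} {τ = τ} ref rστ refl admissible
    with commute (τ , rστ , admissible refl)
  ... | σ' , Rσσ' , rσ'τ' = p , σ' , refl , ref , rσ'τ' , λ _ → Rσσ'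

  record Mirrors {p : Term α} {q : Term β} {n : ℕ}
                 (sqp : PotComp ρ p n) (sqq : PotComp ρ' q n) (σ : α) : Set₂ where
    field
      startState : PotComp.state sqp zero ≡ σ
      envCond    : EnvCond R sqp
      related    : ∀ i → r (PotComp.state sqp i) (PotComp.state sqq i)
      refines    : ∀ i → Refines ρ ρ' r (PotComp.prog sqp i) (PotComp.prog sqq i)
      sameLabels : ∀ i → PotComp.lbl sqp i ≡ PotComp.lbl sqq i

  -- Lifting, by induction on the number of transitions.  The refinement
  -- hypothesis concerns the first program of sqq, so that it can be
  -- re-established for the tail.
  lift : ∀ {n q} (sqq : PotComp ρ' q n) {p σ} →
         Refines ρ ρ' r p (PotComp.prog sqq zero) → r σ (PotComp.state sqq zero) →
         EnvCond R' sqq →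
         Σ (PotComp ρ p n) λ sqp → Mirrors sqp sqq σ
  lift {zero} sqq {p} {σ} ref rστ _ =
    record { cfg = λ _ → (p , σ) ; lbl = λ () ; start = refl ; valid = λ () }
    , record
      { startState = refl
      ; envCond    = λ ()
      ; related    = λ { zero → rστ }
      ; refines    = λ { zero → ref }
      ; sameLabels = λ ()
      }
  lift {suc n} sqq {p} {σ} ref rστ env
    with matchTransition (PotComp.lbl sqq zero) ref rστ
                         (PotComp.valid sqq zero) (env zero)
  ... | p' , σ' , trans , ref' , rσ'τ' , admissible
    with lift (tailComp sqq) ref' rσ'τ' (λ i → env (suc i))
  ... | sqp , m =
    consComp σ (PotComp.lbl sqq zero) sqp
      (subst (Trans ρ (PotComp.lbl sqq zero) (p , σ))
             (sym (headCfg sqp (Mirrors.startState m))) trans)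
    , record
      { startState = refl
      ; envCond    = λ { zero e → subst (R σ) (sym (Mirrors.startState m)) (admissible e)
                       ; (suc i) → Mirrors.envCond m i }
      ; related    = λ { zero → rστ ; (suc i) → Mirrors.related m i }
      ; refines    = λ { zero → ref ; (suc i) → Mirrors.refines m i }
      ; sameLabels = λ { zero → refl ; (suc i) → Mirrors.sameLabels m i }
      }

mainTheorem8 : {α β : Set} (ρ : CodeRet α) (ρ' : CodeRet β)
               (p : Term α) (q : Term β)
               (r : REL α β 0ℓ) (R : Rel α 0ℓ) (R' : Rel β 0ℓ) (n : ℕ)
               (sqq : PotComp ρ' q n) →
               Refines ρ ρ' r p q →
               EnvCond R' sqq →
               (r ⨾ R') ⇒ (R ⨾ r) →
               (σ : α) → r σ (PotComp.state sqq zero) →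
               Σ (PotComp ρ p n) λ sqp →
                 (PotComp.state sqp zero ≡ σ)
                 × EnvCond R sqp
                 × (∀ (i : Fin (suc n)) → r (PotComp.state sqp i) (PotComp.state sqq i))
                 × (∀ (i : Fin (suc n)) → Refines ρ ρ' r (PotComp.prog sqp i) (PotComp.prog sqq i))
                 × (∀ (i : Fin n) → (PotComp.lbl sqp i ≡ envStep) ⇔ (PotComp.lbl sqq i ≡ envStep))
mainTheorem8 ρ ρ' p q r R R' n sqq ref env commute σ rστ
  with lift sqq (subst (Refines ρ ρ' r p) (sym (PotComp.start sqq)) ref) rστ env
  where open Lifting ρ ρ' r R R' commute
... | sqp , m =
  sqp , startState , envCond , related , refines , sameEnvLabels
  where
    open Lifting.Mirrors m
    sameEnvLabels : ∀ i → (PotComp.lbl sqp i ≡ envStep) ⇔ (PotComp.lbl sqq i ≡ envStep)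
    sameEnvLabels i rewrite sameLabels i = mk⇔ id id
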